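{- Let $k$ be a positive integer and let $\lambda=(\lambda_1,\ldots,\lambda_\ell)$ be a $k$-bounded partition (i.e. $\lambda_1\le k$) with $\ell$ positive parts. For $1\le i\le \ell$, let $R(i)$ denote the set of all distinct $(k+1)$-residues of the top cells lying in the $i$-th row of the $(k+1)$-core $\mathfrak{c}(\lambda)$. Then for every $1\le i\le \ell$, \[\Big|\bigcup_{j=i}^{\ell}R(j)\Big|=\lambda_i .\]
   Context: Partitions are identified with Young diagrams in French notation: row $i$ (counted from bottom to top) consists of the cells $(i,1),\ldots,(i,\lambda_i)$. The hook length of a cell $(i,j)$ of a partition is the number of cells of the diagram directly to its right in row $i$ or directly above it in column $j$, counting $(i,j)$ itself once. A partition is a $(k+1)$-core if no cell has hook length $k+1$. The $(k+1)$-residue of the cell $(i,j)$ is $j-i \bmod (k+1)$. A cell $(i,j)$ of a diagram is a top cell if $(i+1,j)$ is not in the diagram. For a $(k+1)$-core $\gamma$, let $\mathfrak{p}(\gamma)$ be the sequence whose $i$-th entry is the number of cells in row $i$ of $\gamma$ with hook length at most $k$; $\mathfrak{p}$ is a bijection (due to Lapointe and Morse) from $(k+1)$-cores onto $k$-bounded partitions, and $\mathfrak{c}$ denotes its inverse. Concretely, $\mathfrak{c}(\lambda)$ is obtained by processing the rows of $\lambda$ from the top row $\ell$ down to row $1$, sliding each row to the right (relative to the rows above, which are already placed) to the first position where no cell of that row has hook length greater than $k$ in the resulting skew diagram; $\mathfrak{c}(\lambda)$ is the outer shape of the resulting skew diagram. -}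

module Defs where

open import Data.Nat using (ℕ; zero; suc; _+_; _∸_; _≤_; _<_; _≤ᵇ_; _<ᵇ_; _≡ᵇ_)
open import Data.Integer using (ℤ; +_; _-_)
open import Data.Integer.DivMod using (_%ℕ_)
open import Data.Bool using (Bool; true; false; if_then_else_; _∧_; not)
open import Data.List using (List; []; _∷_; length; map; filter; upTo; foldr)
open import Data.Bool.ListAction using (all; any)
open import Data.List.Relation.Unary.Linked using (Linked)
open import Data.List.Relation.Unary.All using (All)
open import Data.Product using (_×_; _,_)
open import Relation.Nullary.Decidable using (T?)
open import Data.Bool using (T)

-- Partitions: a partition λ = (λ₁, …, λ_ℓ) is the list [λ₁, …, λ_ℓ]
-- (λ₁ = bottom row in French notation), weakly decreasing, positive parts.

IsPartition : List ℕ → Set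
IsPartition μ = Linked (λ a b → b ≤ a) μ × All (λ a → 0 < a) μ

KBounded : ℕ → List ℕ → Set
KBounded k μ = All (λ a → a ≤ k) μ

-- row μ i = μ_i for 1 ≤ i ≤ ℓ (1-indexed), and 0 otherwise
row : List ℕ → ℕ → ℕ
row []       _             = 0
row (a ∷ _)  1             = a
row (_ ∷ as) (suc (suc i)) = row as (suc i)
row (_ ∷ _)  zero          = 0

-- The map 𝔠 (sliding algorithm).
-- A placed row is (s , a): it occupies columns s+1, …, s+a.
-- Placed rows above the current one are listed from the row directly
-- above upward.

cellsAbove : ℕ → List (ℕ × ℕ) → ℕ
cellsAbove j placed =
  length (filter (λ p → T? (ρ p)) placed)
  where
    ρ : ℕ × ℕ → Bool
    ρ (s , a) = (s <ᵇ j) ∧ (j ≤ᵇ s + a)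

-- Does placing a row of length a at shift s (below the rows `placed`)
-- give only hook lengths ≤ k in that row?  The cell in column s+1+t has
-- (a ∸ t) cells in its row to its right (itself included) and
-- cellsAbove cells above it.
shiftOK : ℕ → ℕ → ℕ → List (ℕ × ℕ) → Bool
shiftOK k s a placed =
  all (λ t → ((a ∸ t) + cellsAbove (s + suc t) placed) ≤ᵇ k) (upTo a)

-- largest column occupied by the placed rows (a shift where nothing is above)
maxCol : List (ℕ × ℕ) → ℕ
maxCol = foldr (λ { (s , a) m → Data.Nat._⊔_ (s + a) m }) 0

firstFrom : (ℕ → Bool) → ℕ → ℕ → ℕ
firstFrom p zero     s = s
firstFrom p (suc n)  s = if p s then s else firstFrom p n (suc s)

slide : ℕ → ℕ → List (ℕ × ℕ) → ℕ
slide k a placed = firstFrom (λ s → shiftOK k s a placed) (maxCol placed) 0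

placeRows : ℕ → List ℕ → List (ℕ × ℕ)
placeRows k []       = []
placeRows k (a ∷ as) = let placed = placeRows k as in (slide k a placed , a) ∷ placed

-- 𝔠(λ): outer shape of the resulting skew diagram (row lengths, bottom first)
core : ℕ → List ℕ → List ℕ
core k μ = map (λ { (s , a) → s + a }) (placeRows k μ)

residue : ℕ → ℕ → ℕ → ℕ
residue k i j = (+ j - + i) %ℕ suc k

-- cell (i , j) of γ (1 ≤ j ≤ γ_i) is a top cell iff (i+1 , j) ∉ γ, i.e. ¬ (j ≤ γ_{i+1})
-- inR k γ i r: residue r belongs to R(i), the set of residues of top cells in row i of γ
inR : ℕ → List ℕ → ℕ → ℕ → Bool
inR k γ i r =
  any (λ j → not (j ≤ᵇ row γ (suc i)) ∧ (residue k i j ≡ᵇ r)) (map suc (upTo (row γ i)))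

inUnionR : ℕ → List ℕ → ℕ → ℕ → ℕ → Bool
inUnionR k γ ℓ i r = any (λ j → inR k γ j r) (map (λ t → i + t) (upTo (suc ℓ ∸ i)))

-- |⋃_{j=i}^{ℓ} R(j)|: all residues lie in {0, …, k}, count those in the union
unionRSize : ℕ → List ℕ → ℕ → ℕ → ℕ
unionRSize k γ ℓ i = length (filter (λ r → T? (inUnionR k γ ℓ i r)) (upTo (suc k)))

-- Write row i of 𝔠(λ) as s skew cells followed by the a = λᵢ cells placed by the
-- sliding algorithm, with S the rows above it. The algorithm maintains that placed
-- cells have hook length ≤ k and skew cells hook length ≥ k + 2. The top cells of
-- the rows j ≥ i correspond to the columns c ≤ s + a: the top cell of column c lies
-- in row i + h(c), where h(c) is the height of column c above row i, so its residue
-- is that of c − h(c) − i. For two placed columns the numbers c − h(c) differ by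
-- 1, …, k because the hooks there are ≤ k, so their residues are distinct. For a
-- skew column c, the hook length s + a + 1 + h(y) − y along row i drops by at least
-- one per column and cannot jump over the value hook(c) − (k + 1): the row above
-- ending at the jump would contain a hook of length exactly k + 1. The column x
-- where that value is attained has x − h(x) = c − h(c) + (k + 1), hence the same
-- residue, and iterating reaches a placed column.

module Submission where

open import Defs
open import Data.Bool using (Bool; true; false; T; not; _∧_)
open import Data.Bool.ListAction using (all; any)
open import Data.Bool.Properties using (T-∧)
open import Data.Empty using (⊥; ⊥-elim)
open import Data.Integer as ℤ using (-[1+_]; _⊖_)
open import Data.Integer.DivMod using (_%ℕ_; n%ℕd<d)
import Data.Integer.Properties as ℤ
open import Data.List using (List; []; _∷_; map; drop; upTo; applyUpTo; filter; length)
open import Data.List.Membership.Propositional using (_∈_)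
open import Data.List.Membership.Propositional.Properties using (∈-filter⁺; ∈-filter⁻; ∈-upTo⁺; ∈-applyUpTo⁺; ∈-applyUpTo⁻)
open import Data.List.Membership.Propositional.Properties.WithK using (unique∧set⇒bag)
open import Data.List.Properties using (map-upTo; map-cong; length-map; length-applyUpTo; length-drop)
open import Data.List.Relation.Binary.BagAndSetEquality using (_∼[_]_; set; ∼bag⇒↭)
open import Data.List.Relation.Binary.Permutation.Propositional.Properties using (↭-length)
open import Data.List.Relation.Unary.All using (_∷_)
open import Data.List.Relation.Unary.All.Properties as All using (all⁺; all⁻; ¬All⇒Any¬)
open import Data.List.Relation.Unary.Any.Properties as Any using (any⁺; any⁻)
open import Data.List.Relation.Unary.Linked as Linked using (Linked; _∷_)
open import Data.List.Relation.Unary.Unique.Propositional.Properties using (filter⁺; upTo⁺; applyUpTo⁺₁)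
open import Data.Nat using (ℕ; zero; suc; _+_; _*_; _∸_; _≤_; _<_; _%_; _<ᵇ_; _≤ᵇ_; NonZero; z≤n; s≤s; z<s; s<s)
open import Data.Nat.DivMod using (%-distribˡ-*; m≤n⇒m%n≡m; [m+kn]%n≡m%n; %-distribˡ-+; m<n⇒m%n≡m; m%n<n; [m+n]%n≡m%n)
open import Data.Nat.Properties
open import Data.Nat.Tactic.RingSolver using (solve-∀)
open import Data.Product using (_×_; _,_; proj₁; proj₂; ∃-syntax)
open import Data.Sum as Sum using (_⊎_; inj₁; inj₂)
open import Data.Unit using (⊤; tt)
open import Function using (_∘_; id; _⇔_; mk⇔; Equivalence)
open import Relation.Binary.Definitions using (tri<; tri≈; tri>)
open import Relation.Binary.PropositionalEquality
open import Relation.Nullary using (¬_; yes; no; contradiction)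
open import Relation.Nullary.Decidable using (dec-true; dec-false; T?)

-- Residues

residue-[j+d] : ∀ k j d → residue k j (j + d) ≡ d % suc k
residue-[j+d] k j d = cong (_%ℕ suc k) (begin
  ℤ.+ (j + d) ℤ.- ℤ.+ j  ≡⟨ ℤ.m-n≡m⊖n (j + d) j ⟩
  (j + d) ⊖ j            ≡⟨ ℤ.⊖-≥ (m≤m+n j d) ⟩
  ℤ.+ (j + d ∸ j)        ≡⟨ cong ℤ.+_ (m+n∸m≡n j d) ⟩
  ℤ.+ d                  ∎)
  where open ≡-Reasoning

residue-[c+1+e] : ∀ k c e → residue k (c + suc e) c ≡ -[1+ e ] %ℕ suc k
residue-[c+1+e] k c e = cong (_%ℕ suc k) (begin
  ℤ.+ c ℤ.- ℤ.+ (c + suc e)  ≡⟨ ℤ.m-n≡m⊖n c (c + suc e) ⟩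
  c ⊖ (c + suc e)            ≡⟨ ℤ.⊖-< (m<m+n c z<s) ⟩
  ℤ.- ℤ.+ (c + suc e ∸ c)    ≡⟨ cong (λ m → ℤ.- ℤ.+ m) (m+n∸m≡n c (suc e)) ⟩
  -[1+ e ]                   ∎)
  where open ≡-Reasoning

%-reduceʳ-* : ∀ k m → (k * m) % suc k ≡ (k * (m % suc k)) % suc k
%-reduceʳ-* k m = trans (%-distribˡ-* k m (suc k)) (cong (λ x → (x * (m % suc k)) % suc k) (m≤n⇒m%n≡m (≤-refl {k})))

-[1+e]%ℕ[1+k] : ∀ k e → -[1+ e ] %ℕ suc k ≡ (k * suc e) % suc k
-[1+e]%ℕ[1+k] k e with suc e % suc k in r≡ | m%n<n (suc e) (suc k)
... | zero  | _       = sym (begin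
  (k * suc e) % suc k             ≡⟨ %-reduceʳ-* k (suc e) ⟩
  (k * (suc e % suc k)) % suc k   ≡⟨ cong (λ r → (k * r) % suc k) r≡ ⟩
  (k * 0) % suc k                 ≡⟨ cong (_% suc k) (*-zeroʳ k) ⟩
  0                               ∎)
  where open ≡-Reasoning
... | suc r | 1+r<1+k = sym (begin
  (k * suc e) % suc k             ≡⟨ %-reduceʳ-* k (suc e) ⟩
  (k * (suc e % suc k)) % suc k   ≡⟨ cong (λ r → (k * r) % suc k) r≡ ⟩
  (k * suc r) % suc k             ≡⟨ cong (_% suc k) (split (k ∸ r) r (m∸n+n≡m r≤k)) ⟩
  (k ∸ r + r * suc k) % suc k     ≡⟨ [m+kn]%n≡m%n (k ∸ r) r (suc k) ⟩
  (k ∸ r) % suc k                 ≡⟨ m<n⇒m%n≡m (s≤s (m∸n≤m k r)) ⟩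
  k ∸ r                           ∎)
  where
  open ≡-Reasoning
  r≤k : r ≤ k
  r≤k = <⇒≤ (≤-pred 1+r<1+k)
  split : ∀ w r {k} → w + r ≡ k → k * suc r ≡ w + r * suc k
  split w r refl = lemma w r
    where
    lemma : ∀ w r → (w + r) * suc r ≡ w + r * suc (w + r)
    lemma = solve-∀

residue≡[c+kj]%[1+k] : ∀ k j c → residue k j c ≡ (c + k * j) % suc k
residue≡[c+kj]%[1+k] k j c with j ≤? c
... | yes j≤c = subst (λ c → residue k j c ≡ (c + k * j) % suc k) (m+[n∸m]≡n j≤c) (above j (c ∸ j))
  where
  above : ∀ j d → residue k j (j + d) ≡ (j + d + k * j) % suc k
  above j d = begin
    residue k j (j + d)        ≡⟨ residue-[j+d] k j d ⟩
    d % suc k                  ≡⟨ [m+kn]%n≡m%n d j (suc k) ⟨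
    (d + j * suc k) % suc k    ≡⟨ cong (_% suc k) (identity j d k) ⟩
    (j + d + k * j) % suc k    ∎
    where
    open ≡-Reasoning
    identity : ∀ j d k → d + j * suc k ≡ j + d + k * j
    identity = solve-∀
... | no j≰c = subst (λ j → residue k j c ≡ (c + k * j) % suc k) c+[j∸c]≡j (below c (j ∸ suc c))
  where
  c+[j∸c]≡j : c + suc (j ∸ suc c) ≡ j
  c+[j∸c]≡j = trans (+-suc c (j ∸ suc c)) (m+[n∸m]≡n (≰⇒> j≰c))
  below : ∀ c e → residue k (c + suc e) c ≡ (c + k * (c + suc e)) % suc k
  below c e = begin
    residue k (c + suc e) c             ≡⟨ residue-[c+1+e] k c e ⟩
    -[1+ e ] %ℕ suc k                   ≡⟨ -[1+e]%ℕ[1+k] k e ⟩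
    (k * suc e) % suc k                 ≡⟨ [m+kn]%n≡m%n (k * suc e) c (suc k) ⟨
    (k * suc e + c * suc k) % suc k     ≡⟨ cong (_% suc k) (identity c e k) ⟩
    (c + k * (c + suc e)) % suc k       ∎
    where
    open ≡-Reasoning
    identity : ∀ c e k → k * suc e + c * suc k ≡ c + k * (c + suc e)
    identity = solve-∀

residue<1+k : ∀ k j c → residue k j c < suc k
residue<1+k k j c = n%ℕd<d (ℤ.+ c ℤ.- ℤ.+ j) (suc k)

residue-shift : ∀ k i {v v′ c c′} e → c′ + v ≡ c + v′ + e →
  residue k (i + v′) c′ ≡ (c + k * (i + v) + e) % suc k
residue-shift k i {v} {v′} {c} {c′} e eq = begin
  residue k (i + v′) c′                              ≡⟨ residue≡[c+kj]%[1+k] k (i + v′) c′ ⟩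
  (c′ + k * (i + v′)) % suc k                        ≡⟨ [m+kn]%n≡m%n (c′ + k * (i + v′)) (i + v) (suc k) ⟨
  (c′ + k * (i + v′) + (i + v) * suc k) % suc k      ≡⟨ cong (_% suc k) (begin
     c′ + k * (i + v′) + (i + v) * suc k               ≡⟨ regroup₁ c′ v i v′ k ⟩
     c′ + v + (i + k * (i + v′) + k * (i + v))        ≡⟨ cong (_+ (i + k * (i + v′) + k * (i + v))) eq ⟩
     c + v′ + e + (i + k * (i + v′) + k * (i + v))    ≡⟨ regroup₂ c v′ e i k v ⟩
     c + k * (i + v) + e + (i + v′) * suc k            ∎) ⟩
  (c + k * (i + v) + e + (i + v′) * suc k) % suc k   ≡⟨ [m+kn]%n≡m%n (c + k * (i + v) + e) (i + v′) (suc k) ⟩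
  (c + k * (i + v) + e) % suc k                      ∎
  where
  open ≡-Reasoning
  regroup₁ : ∀ c′ v i v′ k →
    c′ + k * (i + v′) + (i + v) * suc k ≡ c′ + v + (i + k * (i + v′) + k * (i + v))
  regroup₁ = solve-∀
  regroup₂ : ∀ c v′ e i k v →
    c + v′ + e + (i + k * (i + v′) + k * (i + v)) ≡ c + k * (i + v) + e + (i + v′) * suc k
  regroup₂ = solve-∀

residue-cong : ∀ k i {v v′ c c′} → c′ + v ≡ c + v′ + suc k → residue k (i + v′) c′ ≡ residue k (i + v) c
residue-cong k i {v} {v′} {c} {c′} eq = begin
  residue k (i + v′) c′                  ≡⟨ residue-shift k i {v} {v′} {c} {c′} (suc k) eq ⟩
  (c + k * (i + v) + suc k) % suc k      ≡⟨ [m+n]%n≡m%n (c + k * (i + v)) (suc k) ⟩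
  (c + k * (i + v)) % suc k              ≡⟨ residue≡[c+kj]%[1+k] k (i + v) c ⟨
  residue k (i + v) c                    ∎
  where open ≡-Reasoning

%-+-≢ : ∀ {n} X {δ} .{{_ : NonZero n}} → 0 < δ → δ < n → X % n ≢ (X + δ) % n
%-+-≢ {n} X {δ} 0<δ δ<n eq = r≢[r+δ]%n (m%n<n X n) (begin
  X % n                   ≡⟨ eq ⟩
  (X + δ) % n             ≡⟨ %-distribˡ-+ X δ n ⟩
  (X % n + δ % n) % n     ≡⟨ cong (λ d → (X % n + d) % n) (m<n⇒m%n≡m δ<n) ⟩
  (X % n + δ) % n         ∎)
  where
  open ≡-Reasoning
  r≢[r+δ]%n : ∀ {r} → r < n → r ≢ (r + δ) % n
  r≢[r+δ]%n {r} r<n r≡ with r + δ <? n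
  ... | yes r+δ<n = <⇒≢ (m<m+n r 0<δ) (trans r≡ (m<n⇒m%n≡m r+δ<n))
  ... | no r+δ≮n = <⇒≢ wrapped (sym (trans r≡ (begin
    (r + δ) % n               ≡⟨ cong (_% n) (m∸n+n≡m n≤r+δ) ⟨
    (r + δ ∸ n + n) % n       ≡⟨ [m+n]%n≡m%n (r + δ ∸ n) n ⟩
    (r + δ ∸ n) % n           ≡⟨ m<n⇒m%n≡m (<-trans wrapped r<n) ⟩
    r + δ ∸ n                 ∎)))
    where
    n≤r+δ : n ≤ r + δ
    n≤r+δ = ≮⇒≥ r+δ≮n
    wrapped : r + δ ∸ n < r
    wrapped = +-cancelʳ-< n (r + δ ∸ n) r (subst (_< r + n) (sym (m∸n+n≡m n≤r+δ)) (+-monoʳ-< r δ<n))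

residue-≢ : ∀ k i {v v′ c c′} → c + v′ < c′ + v → c′ + v ≤ c + v′ + k →
  residue k (i + v) c ≢ residue k (i + v′) c′
residue-≢ k i {v} {v′} {c} {c′} lo hi same = %-+-≢ (c + k * (i + v)) (m<n⇒0<n∸m lo) δ<1+k (begin
  (c + k * (i + v)) % suc k         ≡⟨ residue≡[c+kj]%[1+k] k (i + v) c ⟨
  residue k (i + v) c               ≡⟨ same ⟩
  residue k (i + v′) c′             ≡⟨ residue-shift k i {v} {v′} {c} {c′} δ (sym (m+[n∸m]≡n (<⇒≤ lo))) ⟩
  (c + k * (i + v) + δ) % suc k     ∎)
  where
  open ≡-Reasoning
  δ = c′ + v ∸ (c + v′)
  δ<1+k : δ < suc k
  δ<1+k = s≤s (m≤n+o⇒m∸n≤o (c′ + v) (c + v′) hi)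

-- Boolean searches and counting

T-any-map-upTo⇔ : ∀ (p : ℕ → Bool) f n → T (any p (map f (upTo n))) ⇔ (∃[ t ] t < n × T (p (f t)))
T-any-map-upTo⇔ p f n = mk⇔
  (λ h → Any.applyUpTo⁻ f (any⁻ p _ (subst (T ∘ any p) (map-upTo f n) h)))
  (λ (t , t<n , pft) → subst (T ∘ any p) (sym (map-upTo f n)) (any⁺ p (Any.applyUpTo⁺ f pft t<n)))

T-all-upTo⇔ : ∀ (p : ℕ → Bool) n → T (all p (upTo n)) ⇔ (∀ t → t < n → T (p t))
T-all-upTo⇔ p n = mk⇔
  (λ h t t<n → All.applyUpTo⁻ id n (all⁺ p _ h) t<n)
  (λ h → all⁻ p (All.applyUpTo⁺₁ id n (h _)))

¬T-all-upTo : ∀ (p : ℕ → Bool) n → ¬ T (all p (upTo n)) → ∃[ t ] t < n × ¬ T (p t)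
¬T-all-upTo p n h = Any.applyUpTo⁻ id (¬All⇒Any¬ (T? ∘ p) (upTo n) (h ∘ all⁻ p))

T-not⇔¬T : ∀ {b} → T (not b) ⇔ (¬ T b)
T-not⇔¬T {true}  = mk⇔ (λ ()) (λ ¬t → ¬t tt)
T-not⇔¬T {false} = mk⇔ (λ _ ()) (λ _ → tt)

T-inR⇔ : ∀ k γ j r → T (inR k γ j r) ⇔ (∃[ c ] c ≤ row γ j × row γ (suc j) < c × residue k j c ≡ r)
T-inR⇔ k γ j r = mk⇔
  (λ h → let u , u<n , top∧res = Equivalence.to (T-any-map-upTo⇔ _ suc _) h
             top , res = Equivalence.to T-∧ top∧res
         in suc u , u<n , ≰⇒> (Equivalence.to T-not⇔¬T top ∘ ≤⇒≤ᵇ) , ≡ᵇ⇒≡ _ _ res)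
  (λ { (suc u , c≤n , above<c , res) → Equivalence.from (T-any-map-upTo⇔ _ suc _) (u , c≤n ,
         Equivalence.from T-∧ (Equivalence.from T-not⇔¬T (<⇒≱ above<c ∘ ≤ᵇ⇒≤ _ _) , ≡⇒≡ᵇ _ _ res)) })

count-image : ∀ (U : ℕ → Bool) (G : ℕ → ℕ) n a →
  (∀ {t t′} → t < t′ → t′ < a → G t ≢ G t′) → (∀ {t} → t < a → G t < n) →
  (∀ {r} → T (U r) → ∃[ t ] t < a × G t ≡ r) → (∀ {t} → t < a → T (U (G t))) →
  length (filter (T? ∘ U) (upTo n)) ≡ a
count-image U G n a injective bounded onto hits = begin
  length (filter (T? ∘ U) (upTo n))  ≡⟨ ↭-length (∼bag⇒↭ (unique∧set⇒bag unique₁ unique₂ same)) ⟩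
  length (applyUpTo G a)             ≡⟨ length-applyUpTo G a ⟩
  a                                  ∎
  where
  open ≡-Reasoning
  unique₁ = filter⁺ (T? ∘ U) (upTo⁺ n)
  unique₂ = applyUpTo⁺₁ G a injective
  same : filter (T? ∘ U) (upTo n) ∼[ set ] applyUpTo G a
  same = mk⇔
    (λ r∈ → let t , t<a , Gt≡r = onto (proj₂ (∈-filter⁻ (T? ∘ U) {xs = upTo n} r∈)) in
            subst (_∈ _) Gt≡r (∈-applyUpTo⁺ G t<a))
    (λ r∈ → let t , t<a , r≡Gt = ∈-applyUpTo⁻ G r∈ in
            subst (_∈ _) (sym r≡Gt) (∈-filter⁺ (T? ∘ U) (∈-upTo⁺ (bounded t<a)) (hits t<a)))

-- The skew diagram built by the sliding algorithm

-- A placed row (s , a) occupies columns s + 1, …, s + a of a core row of length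
-- outer (s , a); below rows P its cell in column c has hook length
-- s + a + 1 + height c P − c, whence the shape of the two hook conditions.

outer : ℕ × ℕ → ℕ
outer (s , a) = s + a

shiftOf : List (ℕ × ℕ) → ℕ
shiftOf []            = 0
shiftOf ((s , _) ∷ _) = s

lengthOf : List (ℕ × ℕ) → ℕ
lengthOf []            = 0
lengthOf ((_ , a) ∷ _) = a

outerAt : List (ℕ × ℕ) → ℕ → ℕ
outerAt P t = row (map outer P) (suc t)

height : ℕ → List (ℕ × ℕ) → ℕ
height c []      = 0
height c (p ∷ P) with c ≤? outer p
... | yes _ = suc (height c P)
... | no  _ = height c P

Dominates : ℕ × ℕ → List (ℕ × ℕ) → Set
Dominates _       []               = ⊤
Dominates (s , a) ((s′ , a′) ∷ _) = s′ ≤ s × a′ ≤ a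

HooksAtMost : ℕ → ℕ × ℕ → List (ℕ × ℕ) → Set
HooksAtMost k (s , a) P = ∀ c → s < c → c ≤ s + a → s + a + height c P < k + c

HooksBeyond : ℕ → ℕ × ℕ → List (ℕ × ℕ) → Set
HooksBeyond k (s , a) P = ∀ c → 0 < c → c ≤ s → k + c < s + a + height c P

RowFits : ℕ → ℕ → ℕ → List (ℕ × ℕ) → Set
RowFits k s a P = ∀ t → t < a → (a ∸ t) + cellsAbove (s + suc t) P ≤ k

Overflows : ℕ → ℕ → ℕ → List (ℕ × ℕ) → Set
Overflows k s a P = ∃[ t ] t < a × k < (a ∸ t) + cellsAbove (s + suc t) P

Leftmost : ℕ → ℕ × ℕ → List (ℕ × ℕ) → Set
Leftmost k (s , a) P = ∀ s′ → s′ < s → Overflows k s′ a P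

shift-dominated : ∀ {r P} → Dominates r P → shiftOf P ≤ proj₁ r
shift-dominated {P = []}    _           = z≤n
shift-dominated {P = _ ∷ _} (s′≤s , _) = s′≤s

record Fits (k : ℕ) (r : ℕ × ℕ) (P : List (ℕ × ℕ)) : Set where
  field
    dominates : Dominates r P
    short     : HooksAtMost k r P
    long      : HooksBeyond k r P
    leftmost  : Leftmost k r P

data Admissible (k : ℕ) : List (ℕ × ℕ) → Set where
  []  : Admissible k []
  _∷_ : ∀ {r P} → Fits k r P → Admissible k P → Admissible k (r ∷ P)

cellsAbove-∷ : ∀ c p P → cellsAbove c P ≤ cellsAbove c (p ∷ P)
cellsAbove-∷ c (s , a) P with (s <ᵇ c) ∧ (c ≤ᵇ s + a)
... | true  = n≤1+n _
... | false = ≤-refl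

height-antitone : ∀ P {c c′} → c ≤ c′ → height c′ P ≤ height c P
height-antitone []      _ = z≤n
height-antitone (p ∷ P) {c} {c′} c≤c′ with c′ ≤? outer p | c ≤? outer p
... | yes _    | yes _  = s≤s (height-antitone P c≤c′)
... | yes c′≤w | no c≰w = contradiction (≤-trans c≤c′ c′≤w) c≰w
... | no _     | yes _  = m≤n⇒m≤1+n (height-antitone P c≤c′)
... | no _     | no _   = height-antitone P c≤c′

height-≤-length : ∀ c P → height c P ≤ length P
height-≤-length c []      = z≤n
height-≤-length c (p ∷ P) with c ≤? outer p
... | yes _ = s≤s (height-≤-length c P)
... | no  _ = m≤n⇒m≤1+n (height-≤-length c P)

outerAt-drop : ∀ P m t → outerAt P (m + t) ≡ outerAt (drop m P) t
outerAt-drop P       zero    t = refl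
outerAt-drop []      (suc m) t = refl
outerAt-drop (p ∷ P) (suc m) t = outerAt-drop P m t

head-fits : ∀ {k r P} → Admissible k (r ∷ P) → Fits k r P
head-fits (f ∷ _) = f

drop-admissible : ∀ {k P} m → Admissible k P → Admissible k (drop m P)
drop-admissible zero    A       = A
drop-admissible (suc m) []      = []
drop-admissible (suc m) (_ ∷ A) = drop-admissible m A

firstFrom-minimal : ∀ (p : ℕ → Bool) n {z y} → z ≤ y → y < firstFrom p n z → ¬ T (p y)
firstFrom-minimal p zero z≤y y<z = contradiction z≤y (<⇒≱ y<z)
firstFrom-minimal p (suc n) {z} {y} z≤y y<f with p z in pz
... | true  = contradiction z≤y (<⇒≱ y<f)
... | false with z ≟ y
...   | yes refl = subst T pz
...   | no  z≢y  = firstFrom-minimal p n (≤∧≢⇒< z≤y z≢y) y<f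

firstFrom-found : ∀ (p : ℕ → Bool) n z → T (p (firstFrom p n z)) ⊎ firstFrom p n z ≡ z + n
firstFrom-found p zero    z = inj₂ (sym (+-identityʳ z))
firstFrom-found p (suc n) z with p z in pz
... | true  = inj₁ (subst T (sym pz) _)
... | false = Sum.map₂ (λ eq → trans eq (sym (+-suc z n))) (firstFrom-found p n (suc z))

T-shiftOK⇔ : ∀ k s a P → T (shiftOK k s a P) ⇔ RowFits k s a P
T-shiftOK⇔ k s a P = mk⇔
  (λ ok t t<a → ≤ᵇ⇒≤ _ _ (Equivalence.to (T-all-upTo⇔ _ a) ok t t<a))
  (λ fits → Equivalence.from (T-all-upTo⇔ _ a) (λ t t<a → ≤⇒≤ᵇ (fits t t<a)))

¬T-shiftOK : ∀ k s a P → ¬ T (shiftOK k s a P) → Overflows k s a P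
¬T-shiftOK k s a P bad with ¬T-all-upTo _ a bad
... | t , t<a , ¬ok = t , t<a , ≰⇒> (¬ok ∘ ≤⇒≤ᵇ)

module _ {k : ℕ} where

  tail : ∀ {r P} → Admissible k (r ∷ P) → Admissible k P
  tail (_ ∷ A) = A

  width-antitone : ∀ {r P} → Admissible k (r ∷ P) → outerAt P 0 ≤ outer r
  width-antitone {P = []}    _ = z≤n
  width-antitone {P = _ ∷ _} (f ∷ _) with Fits.dominates f
  ... | s′≤s , a′≤a = +-mono-≤ s′≤s a′≤a

  shift-antitone : ∀ {r P} → Admissible k (r ∷ P) → shiftOf P ≤ proj₁ r
  shift-antitone (f ∷ _) = shift-dominated (Fits.dominates f)

  outerAt≤width : ∀ {P} → Admissible k P → ∀ m → outerAt P m ≤ outerAt P 0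
  outerAt≤width []      m       = z≤n
  outerAt≤width (_ ∷ _) zero    = ≤-refl
  outerAt≤width (f ∷ A) (suc m) = ≤-trans (outerAt≤width A m) (width-antitone (f ∷ A))

  height-beyond : ∀ {P c} → Admissible k P → outerAt P 0 < c → height c P ≡ 0
  height-beyond {[]}    _ _ = refl
  height-beyond {p ∷ P} {c} A w<c with c ≤? outer p
  ... | yes c≤w = contradiction c≤w (<⇒≱ w<c)
  ... | no  _   = height-beyond (tail A) (≤-<-trans (width-antitone A) w<c)

  height-above-short : ∀ {p P c} → Admissible k (p ∷ P) → ¬ c ≤ outer p → height c P ≡ 0
  height-above-short A c≰w = height-beyond (tail A) (≤-<-trans (width-antitone A) (≰⇒> c≰w))

  <height⇒≤outerAt : ∀ {P c m} → Admissible k P → m < height c P → c ≤ outerAt P m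
  <height⇒≤outerAt {p ∷ P} {c} {m} A m<h with c ≤? outer p
  <height⇒≤outerAt {m = zero}  A m<h         | yes c≤w = c≤w
  <height⇒≤outerAt {m = suc m} A (s≤s m<h)   | yes _   = <height⇒≤outerAt (tail A) m<h
  ... | no c≰w = contradiction (subst (_ <_) (height-above-short A c≰w) m<h) λ ()

  ≤outerAt⇒<height : ∀ {P c m} → Admissible k P → 0 < c → c ≤ outerAt P m → m < height c P
  ≤outerAt⇒<height {[]}    _ 0<c c≤0 = contradiction c≤0 (<⇒≱ 0<c)
  ≤outerAt⇒<height {p ∷ P} {c} {m} A 0<c c≤o with c ≤? outer p
  ≤outerAt⇒<height {m = zero}  A 0<c c≤o | yes _ = z<s
  ≤outerAt⇒<height {m = suc m} A 0<c c≤o | yes _ = s<s (≤outerAt⇒<height (tail A) 0<c c≤o)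
  ... | no c≰w = contradiction (≤-trans c≤o (outerAt≤width A m)) c≰w

  height-drop : ∀ {P c} m → Admissible k P → m ≤ height c P → height c (drop m P) + m ≡ height c P
  height-drop             zero    _ _ = +-identityʳ _
  height-drop {p ∷ P} {c} (suc m) A m<h with c ≤? outer p
  ... | yes _  = trans (+-suc _ m) (cong suc (height-drop m (tail A) (≤-pred m<h)))
  ... | no c≰w = contradiction (subst (_ <_) (height-above-short A c≰w) m<h) λ ()

  cellsAbove≡height : ∀ {P c} → Admissible k P → shiftOf P < c → cellsAbove c P ≡ height c P
  cellsAbove≡height {[]}          _ _ = refl
  cellsAbove≡height {(s , a) ∷ P} {c} A s<c with c ≤? s + a
  ... | yes c≤w rewrite dec-true (s <? c) s<c | dec-true (c ≤? s + a) c≤w =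
    cong suc (cellsAbove≡height (tail A) (≤-<-trans (shift-antitone A) s<c))
  ... | no c≰w rewrite dec-true (s <? c) s<c | dec-false (c ≤? s + a) c≰w =
    cellsAbove≡height (tail A) (≤-<-trans (shift-antitone A) s<c)

  cellsAbove-beyond : ∀ {P c} → Admissible k P → outerAt P 0 < c → cellsAbove c P ≡ 0
  cellsAbove-beyond {[]}    _ _ = refl
  cellsAbove-beyond {(s , a) ∷ P} A w<c =
    trans (cellsAbove≡height A (≤-<-trans (m≤m+n s a) w<c)) (height-beyond A w<c)

  maxCol≡width : ∀ {P} → Admissible k P → maxCol P ≡ outerAt P 0
  maxCol≡width []      = refl
  maxCol≡width (f ∷ A) rewrite maxCol≡width A = m≥n⇒m⊔n≡m (width-antitone (f ∷ A))

  slide-fits : ∀ {a P} → Admissible k P → a ≤ k → RowFits k (slide k a P) a P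
  slide-fits {a} {P} A a≤k with firstFrom-found (λ s → shiftOK k s a P) (maxCol P) 0
  ... | inj₁ ok  = Equivalence.to (T-shiftOK⇔ k (slide k a P) a P) ok
  ... | inj₂ s≡w = λ t t<a → begin
    a ∸ t + cellsAbove (slide k a P + suc t) P ≡⟨ cong ((a ∸ t) +_) (cellsAbove-beyond A (beyond t)) ⟩
    a ∸ t + 0                                   ≡⟨ +-identityʳ (a ∸ t) ⟩
    a ∸ t                                       ≤⟨ m∸n≤m a t ⟩
    a                                           ≤⟨ a≤k ⟩
    k                                           ∎
    where
    open ≤-Reasoning
    beyond : ∀ t → outerAt P 0 < slide k a P + suc t
    beyond t = subst (λ w → w < slide k a P + suc t) (trans s≡w (maxCol≡width A)) (m<m+n _ z<s)

  slide-leftmost : ∀ {a} P → Leftmost k (slide k a P , a) P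
  slide-leftmost {a} P s′ s′<s = ¬T-shiftOK k s′ a P (firstFrom-minimal _ (maxCol P) z≤n s′<s)

  fits⇒dominates : ∀ {s a P} → Admissible k P → lengthOf P ≤ a → RowFits k s a P → Dominates (s , a) P
  fits⇒dominates [] _ _ = tt
  fits⇒dominates {s} {a} {(s₁ , a₁) ∷ P} (f ∷ _) a₁≤a fits with s₁ ≤? s
  ... | yes s₁≤s = s₁≤s , a₁≤a
  ... | no  s₁≰s with Fits.leftmost f s (≰⇒> s₁≰s)
  ...   | t , t<a₁ , overflow = contradiction (fits t (<-≤-trans t<a₁ a₁≤a)) (<⇒≱ (<-≤-trans overflow
            (+-mono-≤ (∸-monoˡ-≤ t a₁≤a) (cellsAbove-∷ (s + suc t) (s₁ , a₁) P))))

  fits⇒hooksAtMost : ∀ {s a P} → Admissible k P → shiftOf P ≤ s → RowFits k s a P → HooksAtMost k (s , a) P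
  fits⇒hooksAtMost {s} {a} {P} A sP≤s fits c s<c c≤s+a = begin
    suc (s + a + height c P)             ≡⟨ cong₂ (λ a c → suc (s + a + height c P)) (sym t+u≡a) (sym c′≡c) ⟩
    suc (s + (t + (a ∸ t)) + height c′ P) ≡⟨ regroup s t (a ∸ t) (height c′ P) ⟩
    (a ∸ t) + height c′ P + c′           ≤⟨ +-monoˡ-≤ c′ hook ⟩
    k + c′                               ≡⟨ cong (k +_) c′≡c ⟩
    k + c                                ∎
    where
    open ≤-Reasoning
    t = c ∸ suc s
    c′ = s + suc t
    c′≡c : c′ ≡ c
    c′≡c = trans (+-suc s t) (m+[n∸m]≡n s<c)
    t<a : t < a
    t<a = +-cancelˡ-< s t a (subst (_≤ s + a) (trans (sym c′≡c) (+-suc s t)) c≤s+a)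
    t+u≡a : t + (a ∸ t) ≡ a
    t+u≡a = m+[n∸m]≡n (<⇒≤ t<a)
    hook : (a ∸ t) + height c′ P ≤ k
    hook = subst (λ h → (a ∸ t) + h ≤ k) (cellsAbove≡height A (≤-<-trans sP≤s (m<m+n s z<s))) (fits t t<a)
    regroup : ∀ s t u h → suc (s + (t + u) + h) ≡ u + h + (s + suc t)
    regroup = solve-∀

  overflow⇒hookAtShift : ∀ {s a P} → Admissible k P → shiftOf P < suc s → HooksAtMost k (suc s , a) P →
    Overflows k s a P → k + suc s < suc s + a + height (suc s) P
  overflow⇒hookAtShift {s} {a} {P} A sP<s _ (zero , _ , overflow) = begin-strict
    k + suc s                  <⟨ +-monoˡ-< (suc s) overflow′ ⟩
    a + height (suc s) P + suc s ≡⟨ regroup a (height (suc s) P) (suc s) ⟩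
    suc s + a + height (suc s) P ∎
    where
    open ≤-Reasoning
    overflow′ : k < a + height (suc s) P
    overflow′ = subst (λ h → k < a + h)
      (trans (cong (λ c → cellsAbove c P) (+-comm s 1)) (cellsAbove≡height A sP<s)) overflow
    regroup : ∀ a h s → a + h + s ≡ s + a + h
    regroup = solve-∀
  -- The overflowing cell also belongs to the row at shift s + 1, where hooks are ≤ k.
  overflow⇒hookAtShift {s} {a} {P} A sP<s short (suc t , t<a , overflow) = contradiction (begin-strict
    k + c                             <⟨ +-monoˡ-< c overflow′ ⟩
    (a ∸ suc t) + h + c               ≡⟨ regroup (a ∸ suc t) h s t ⟩
    suc s + ((a ∸ suc t) + suc t) + h ≡⟨ cong (λ a → suc s + a + h) (m∸n+n≡m (<⇒≤ t<a)) ⟩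
    suc s + a + h                     <⟨ short c (m<m+n (suc s) z<s) (+-monoʳ-≤ (suc s) (<⇒≤ t<a)) ⟩
    k + c                             ∎) (<-irrefl refl)
    where
    open ≤-Reasoning
    c = suc s + suc t
    h = height c P
    overflow′ : k < (a ∸ suc t) + h
    overflow′ = subst (λ n → k < (a ∸ suc t) + n)
      (trans (cong (λ c → cellsAbove c P) (+-suc s (suc t)))
             (cellsAbove≡height A (<-≤-trans sP<s (m≤m+n (suc s) (suc t)))))
      overflow
    regroup : ∀ x h s t → x + h + (suc s + suc t) ≡ suc s + (x + suc t) + h
    regroup = solve-∀

  stacked⇒hookAtShift : ∀ {s a a₁ P} → Fits k (s , a₁) P → a₁ ≤ a → 0 < s →
    k + s < s + a + height s ((s , a₁) ∷ P)
  stacked⇒hookAtShift {s} {a} {a₁} {P} f a₁≤a 0<s with s ≤? s + a₁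
  ... | no s≰s+a₁ = contradiction (m≤m+n s a₁) s≰s+a₁
  ... | yes _ = begin-strict
    k + s                    <⟨ Fits.long f s 0<s ≤-refl ⟩
    s + a₁ + height s P      ≤⟨ +-monoˡ-≤ (height s P) (+-monoʳ-≤ s a₁≤a) ⟩
    s + a + height s P       <⟨ +-monoʳ-< (s + a) (n<1+n _) ⟩
    s + a + suc (height s P) ∎
    where open ≤-Reasoning

  leftmost⇒hooksBeyond : ∀ {s a P} → Admissible k P → lengthOf P ≤ a → shiftOf P ≤ s →
    Leftmost k (s , a) P → HooksAtMost k (s , a) P → HooksBeyond k (s , a) P
  leftmost⇒hooksBeyond {s} {a} {P} A P≤a sP≤s left short c 0<c c≤s = begin-strict
    k + c              ≤⟨ +-monoʳ-≤ k c≤s ⟩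
    k + s              <⟨ atShift P A P≤a sP≤s left short (<-≤-trans 0<c c≤s) ⟩
    s + a + height s P ≤⟨ +-monoʳ-≤ (s + a) (height-antitone P c≤s) ⟩
    s + a + height c P ∎
    where
    open ≤-Reasoning
    atShift : ∀ {s} P → Admissible k P → lengthOf P ≤ a → shiftOf P ≤ s → Leftmost k (s , a) P →
      HooksAtMost k (s , a) P → 0 < s → k + s < s + a + height s P
    atShift {suc s₀} P A P≤a sP≤s left short _ with m≤n⇒m<n∨m≡n sP≤s
    ... | inj₁ sP<s = overflow⇒hookAtShift A sP<s short (left s₀ (n<1+n s₀))
    atShift ((_ , a₁) ∷ P) (f ∷ _) a₁≤a _ _ _ 0<s | inj₂ refl = stacked⇒hookAtShift f a₁≤a 0<s

  slide-fits-row : ∀ {a P} → Admissible k P → a ≤ k → lengthOf P ≤ a → Fits k (slide k a P , a) P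
  slide-fits-row {a} {P} A a≤k P≤a = record
    { dominates = dominates
    ; short     = short
    ; long      = leftmost⇒hooksBeyond A P≤a (shift-dominated dominates) (slide-leftmost P) short
    ; leftmost  = slide-leftmost P
    }
    where
    dominates = fits⇒dominates A P≤a (slide-fits A a≤k)
    short = fits⇒hooksAtMost A (shift-dominated dominates) (slide-fits A a≤k)

  -- Columns, hooks and residues

  no-hook-k+1 : ∀ {r P c} → Fits k r P → 0 < c → c ≤ outer r → outer r + height c P ≢ k + c
  no-hook-k+1 {s , a} {P} {c} f 0<c c≤w eq with s <? c
  ... | yes s<c = <-irrefl eq (Fits.short f c s<c c≤w)
  ... | no  s≮c = <-irrefl (sym eq) (Fits.long f c 0<c (≮⇒≥ s≮c))

  no-hook-k+1-at : ∀ {P c} m → Admissible k P → 0 < c → c ≤ outerAt P m →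
    outerAt P m + height c (drop (suc m) P) ≢ k + c
  no-hook-k+1-at {[]}    _       _       0<c c≤0 = contradiction c≤0 (<⇒≱ 0<c)
  no-hook-k+1-at {_ ∷ _} zero    (f ∷ _) = no-hook-k+1 f
  no-hook-k+1-at {_ ∷ _} (suc m) (_ ∷ A) = no-hook-k+1-at m A

  -- A row of length L below S has hook length (t + 1) + (k + 1) in column c. If its hook
  -- lengths L + 1 + height y S − y skipped the value t + 1 between columns y and y + 1,
  -- the row of S ending in column y would have hook length k + 1 in column c.
  no-jump : ∀ {S L t c y} → Admissible k S → 0 < c → c ≤ y → L + height c S ≡ t + suc k + c →
    L + height (suc y) S ≤ t + y → t + y < L + height y S → ⊥
  no-jump {S} {L} {t} {c} {y} A 0<c c≤y hook low high =
    no-hook-k+1-at m A 0<c (subst (c ≤_) (sym row≡y) c≤y) row-hook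
    where
    open ≡-Reasoning
    m = t + y ∸ L
    m+L≡t+y : m + L ≡ t + y
    m+L≡t+y = m∸n+n≡m (≤-trans (m≤m+n L _) low)
    h[1+y]≤m : height (suc y) S ≤ m
    h[1+y]≤m = +-cancelʳ-≤ L _ _ (subst₂ _≤_ (+-comm L _) (sym m+L≡t+y) low)
    m<h[y] : m < height y S
    m<h[y] = +-cancelʳ-< L _ _ (subst₂ _<_ (sym m+L≡t+y) (+-comm L _) high)
    row≡y : outerAt S m ≡ y
    row≡y = ≤-antisym
      (≮⇒≥ λ y<row → <⇒≱ (≤outerAt⇒<height A z<s y<row) h[1+y]≤m)
      (<height⇒≤outerAt A m<h[y])
    h′ = height c (drop (suc m) S)
    h′+1+m≡h : h′ + suc m ≡ height c S
    h′+1+m≡h = height-drop (suc m) A (≤-trans m<h[y] (height-antitone S c≤y))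
    row-hook : outerAt S m + h′ ≡ k + c
    row-hook = +-cancelʳ-≡ (suc m + L) _ _ (begin
      outerAt S m + h′ + (suc m + L)   ≡⟨ cong (λ o → o + h′ + (suc m + L)) row≡y ⟩
      y + h′ + (suc m + L)             ≡⟨ regroup₁ y h′ m L ⟩
      y + (L + (h′ + suc m))           ≡⟨ cong (λ h → y + (L + h)) h′+1+m≡h ⟩
      y + (L + height c S)             ≡⟨ cong (y +_) hook ⟩
      y + (t + suc k + c)              ≡⟨ regroup₂ y t k c ⟩
      k + c + suc (t + y)              ≡⟨ cong (λ n → k + c + suc n) m+L≡t+y ⟨
      k + c + (suc m + L)              ∎)
      where
      regroup₁ : ∀ y h m L → y + h + (suc m + L) ≡ y + (L + (h + suc m))
      regroup₁ = solve-∀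
      regroup₂ : ∀ y t k c → y + (t + suc k + c) ≡ k + c + suc (t + y)
      regroup₂ = solve-∀

  hook-descends : ∀ {S L t c} → Admissible k S → outerAt S 0 ≤ L → 0 < c → L + height c S ≡ t + suc k + c →
    ∀ d {y} → d + y ≡ L → c ≤ y → t + y < L + height y S → ∃[ x ] y < x × x ≤ L × L + height x S ≡ t + x
  hook-descends {S} {t = t} A w≤L 0<c hook zero {y} refl c≤y above = ⊥-elim (no-jump A 0<c c≤y hook low above)
    where
    low : y + height (suc y) S ≤ t + y
    low = subst (λ h → y + h ≤ t + y) (sym (height-beyond A (s≤s w≤L)))
            (subst (_≤ t + y) (sym (+-identityʳ y)) (m≤n+m y t))
  hook-descends {S} {L} {t} A w≤L 0<c hook (suc d) {y} d+y≡L c≤y above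
    with <-cmp (t + suc y) (L + height (suc y) S)
  ... | tri≈ _ eq _ = suc y , n<1+n y , subst (suc y ≤_) d+y≡L (s≤s (m≤n+m y d)) , sym eq
  ... | tri> _ _ gt = ⊥-elim (no-jump A 0<c c≤y hook (≤-pred (subst (L + height (suc y) S <_) (+-suc t y) gt)) above)
  ... | tri< lt _ _ with hook-descends A w≤L 0<c hook d (trans (+-suc d y) d+y≡L) (m≤n⇒m≤1+n c≤y) lt
  ...   | x , 1+y<x , x≤L , eq = x , <-trans (n<1+n y) 1+y<x , x≤L , eq

  skew-step : ∀ {s a S c} → Admissible k ((s , a) ∷ S) → 0 < c → c ≤ s →
    ∃[ x ] c < x × x ≤ s + a × x + height c S ≡ c + height x S + suc k
  skew-step {s} {a} {S} {c} A@(f ∷ A′) 0<c c≤s =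
    conclude (hook-descends A′ (width-antitone A) 0<c hook (L ∸ c) (m∸n+n≡m c≤L) ≤-refl start)
    where
    open ≡-Reasoning
    L = s + a
    c≤L : c ≤ L
    c≤L = ≤-trans c≤s (m≤m+n s a)
    long : suc (k + c) ≤ L + height c S
    long = Fits.long f c 0<c c≤s
    t = L + height c S ∸ suc (k + c)
    hook : L + height c S ≡ t + suc k + c
    hook = trans (sym (m∸n+n≡m long)) (sym (+-assoc t (suc k) c))
    start : t + c < L + height c S
    start = subst (t + c <_) (sym hook) (+-monoˡ-< c (m<m+n t z<s))
    conclude : ∃[ x ] c < x × x ≤ L × L + height x S ≡ t + x →
      ∃[ x ] c < x × x ≤ L × x + height c S ≡ c + height x S + suc k
    conclude (x , c<x , x≤L , hx) = x , c<x , x≤L , +-cancelʳ-≡ L _ _ (begin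
      x + height c S + L            ≡⟨ regroup₁ x (height c S) L ⟩
      x + (L + height c S)          ≡⟨ cong (x +_) hook ⟩
      x + (t + suc k + c)           ≡⟨ regroup₂ x t k c ⟩
      c + suc k + (t + x)           ≡⟨ cong (c + suc k +_) hx ⟨
      c + suc k + (L + height x S)  ≡⟨ regroup₃ c k L (height x S) ⟩
      c + height x S + suc k + L    ∎)
      where
      regroup₁ : ∀ x h L → x + h + L ≡ x + (L + h)
      regroup₁ = solve-∀
      regroup₂ : ∀ x t k c → x + (t + suc k + c) ≡ c + suc k + (t + x)
      regroup₂ = solve-∀
      regroup₃ : ∀ c k L h → c + suc k + (L + h) ≡ c + h + suc k + L
      regroup₃ = solve-∀

  -- d is fuel: each step moves c strictly to the right, and s < c + d.
  skew-partner : ∀ {s a S} → Admissible k ((s , a) ∷ S) → ∀ i d {c} → s < c + d → 0 < c → c ≤ s →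
    ∃[ c′ ] s < c′ × c′ ≤ s + a × residue k (i + height c′ S) c′ ≡ residue k (i + height c S) c
  skew-partner A i zero {c} s<c _ c≤s = contradiction c≤s (<⇒≱ (subst (_ <_) (+-identityʳ c) s<c))
  skew-partner {s} A i (suc d) s<c+d 0<c c≤s with skew-step A 0<c c≤s
  ... | x , c<x , x≤L , shift with s <? x
  ...   | yes s<x = x , s<x , x≤L , residue-cong k i shift
  ...   | no  s≮x with skew-partner A i d (<-≤-trans s<c+d (subst (_≤ x + d) (sym (+-suc _ d)) (+-monoˡ-≤ d c<x)))
                                        (<-trans 0<c c<x) (≮⇒≥ s≮x)
  ...     | c′ , s<c′ , c′≤L , same = c′ , s<c′ , c′≤L , trans same (residue-cong k i shift)

  row-columns-separated : ∀ {s a S x x′} → Fits k (s , a) S → s < x → x < x′ → x′ ≤ s + a →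
    x + height x′ S < x′ + height x S × x′ + height x S ≤ x + height x′ S + k
  row-columns-separated {s} {a} {S} {x} {x′} f s<x x<x′ x′≤L =
    +-mono-<-≤ x<x′ (height-antitone S (<⇒≤ x<x′)) , <⇒≤ (begin-strict
      x′ + height x S         ≤⟨ +-monoˡ-≤ (height x S) x′≤L ⟩
      s + a + height x S      <⟨ Fits.short f x s<x (≤-trans (<⇒≤ x<x′) x′≤L) ⟩
      k + x                   ≤⟨ m≤m+n (k + x) (height x′ S) ⟩
      k + x + height x′ S     ≡⟨ regroup k x (height x′ S) ⟩
      x + height x′ S + k     ∎)
    where
    open ≤-Reasoning
    regroup : ∀ k x h → k + x + h ≡ x + h + k
    regroup = solve-∀

  top-cell-height : ∀ {r S t c} → Admissible k (r ∷ S) → c ≤ outerAt (r ∷ S) t → outerAt S t < c →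
    t ≡ height c S
  top-cell-height {t = zero}  (_ ∷ A) _   o<c = sym (height-beyond A o<c)
  top-cell-height {t = suc t} (_ ∷ A) c≤o o<c = ≤-antisym
    (≤outerAt⇒<height A (≤-<-trans z≤n o<c) c≤o)
    (≮⇒≥ λ 1+t<h → <⇒≱ o<c (<height⇒≤outerAt A 1+t<h))

  top-cell : ∀ {r S t c} → Admissible k (r ∷ S) → c ≤ outerAt (r ∷ S) t → outerAt S t < c →
    t ≡ height c S × 0 < c × c ≤ outer r
  top-cell {t = t} A c≤o o<c = top-cell-height A c≤o o<c , ≤-<-trans z≤n o<c , ≤-trans c≤o (outerAt≤width A t)

  top-cell-at-height : ∀ {r S c} → Admissible k (r ∷ S) → 0 < c → c ≤ outer r →
    c ≤ outerAt (r ∷ S) (height c S) × outerAt S (height c S) < c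
  top-cell-at-height {r} {S} {c} (_ ∷ A) 0<c c≤w = on-row , ≰⇒> (<-irrefl refl ∘ ≤outerAt⇒<height A 0<c)
    where
    on-row : c ≤ outerAt (r ∷ S) (height c S)
    on-row with height c S in h≡
    ... | zero  = c≤w
    ... | suc h = <height⇒≤outerAt A (subst (h <_) (sym h≡) ≤-refl)

placeRows-admissible : ∀ k μ → Linked (λ a b → b ≤ a) μ → KBounded k μ → Admissible k (placeRows k μ)
placeRows-admissible k []       _                _            = []
placeRows-admissible k (a ∷ as) dec (a≤k ∷ bnd) =
  slide-fits-row A a≤k (next≤ as dec) ∷ A
  where
  A = placeRows-admissible k as (Linked.tail dec) bnd
  next≤ : ∀ as → Linked (λ a b → b ≤ a) (a ∷ as) → lengthOf (placeRows k as) ≤ a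
  next≤ []       _           = z≤n
  next≤ (_ ∷ _)  (b≤a ∷ _)   = b≤a

placeRows-lengths : ∀ k μ → map proj₂ (placeRows k μ) ≡ μ
placeRows-lengths k []       = refl
placeRows-lengths k (a ∷ as) = cong (a ∷_) (placeRows-lengths k as)

core≡map-outer : ∀ k μ → core k μ ≡ map outer (placeRows k μ)
core≡map-outer k μ = map-cong (λ { (s , a) → refl }) (placeRows k μ)

row-split : ∀ (Q : List (ℕ × ℕ)) i₀ → i₀ < length Q →
  ∃[ s ] ∃[ a ] ∃[ S ] drop i₀ Q ≡ (s , a) ∷ S × row (map proj₂ Q) (suc i₀) ≡ a
row-split ((s , a) ∷ S) zero    _          = s , a , S , refl , refl
row-split (_ ∷ Q)       (suc i₀) (s≤s i₀<ℓ) = row-split Q i₀ i₀<ℓ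

module _ {k : ℕ} {Q : List (ℕ × ℕ)} (A : Admissible k Q) {i₀ s a S} (split : drop i₀ Q ≡ (s , a) ∷ S) where

  private
    γ = map outer Q
    ℓ = length Q
    i = suc i₀

    AR : Admissible k ((s , a) ∷ S)
    AR = subst (Admissible k) split (drop-admissible i₀ A)

    F : ℕ → ℕ
    F c = residue k (i + height c S) c

    row-at : ∀ t → row γ (i + t) ≡ outerAt ((s , a) ∷ S) t
    row-at t = trans (outerAt-drop Q i₀ t) (cong (λ P → outerAt P t) split)

    row-above : ∀ t → row γ (suc (i + t)) ≡ outerAt S t
    row-above t = trans (cong (outerAt Q) (sym (+-suc i₀ t))) (row-at (suc t))

  union⊆ : ∀ {r} → T (inUnionR k γ ℓ i r) → ∃[ c ] s < c × c ≤ s + a × F c ≡ r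
  union⊆ {r} h with Equivalence.to (T-any-map-upTo⇔ _ (i +_) (suc ℓ ∸ i)) h
  ... | t , _ , in-row with Equivalence.to (T-inR⇔ k γ (i + t) r) in-row
  ... | c , c≤row , above<c , res with top-cell AR (subst (c ≤_) (row-at t) c≤row) (subst (_< c) (row-above t) above<c)
  ... | refl , 0<c , c≤L with s <? c
  ...   | yes s<c = c , s<c , c≤L , res
  ...   | no  s≮c with skew-partner AR i s (m<n+m s 0<c) 0<c (≮⇒≥ s≮c)
  ...     | c′ , s<c′ , c′≤L , same = c′ , s<c′ , c′≤L , trans same res

  union⊇ : ∀ {c} → s < c → c ≤ s + a → T (inUnionR k γ ℓ i (F c))
  union⊇ {c} s<c c≤L = Equivalence.from (T-any-map-upTo⇔ _ (i +_) (suc ℓ ∸ i)) (height c S , h<ℓ-i₀ ,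
    Equivalence.from (T-inR⇔ k γ (i + height c S) (F c))
      (c , subst (c ≤_) (sym (row-at _)) on-row , subst (_< c) (sym (row-above _)) above<c , refl))
    where
    on-row×above<c = top-cell-at-height AR (≤-<-trans z≤n s<c) c≤L
    on-row = proj₁ on-row×above<c
    above<c = proj₂ on-row×above<c
    h<ℓ-i₀ : height c S < ℓ ∸ i₀
    h<ℓ-i₀ = subst (height c S <_) (trans (cong length (sym split)) (length-drop i₀ Q)) (s≤s (height-≤-length c S))

  F-injective : ∀ {x x′} → s < x → x < x′ → x′ ≤ s + a → F x ≢ F x′
  F-injective {x} {x′} s<x x<x′ x′≤L with row-columns-separated (head-fits AR) s<x x<x′ x′≤L
  ... | lo , hi = residue-≢ k i {height x S} {height x′ S} {x} {x′} lo hi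

  unionRSize≡ : unionRSize k γ ℓ i ≡ a
  unionRSize≡ = count-image (inUnionR k γ ℓ i) (λ t → F (suc s + t)) (suc k) a
    (λ {t} t<t′ t′<a → F-injective (s<1+s+t t) (+-monoʳ-< (suc s) t<t′) (column≤L t′<a))
    (λ {t} _ → residue<1+k k (i + height (suc s + t) S) (suc s + t))
    (λ Ur → let c , s<c , c≤L , Fc≡r = union⊆ Ur in
      c ∸ suc s , offset<a s<c c≤L , trans (cong F (m+[n∸m]≡n s<c)) Fc≡r)
    (λ {t} t<a → union⊇ (s<1+s+t t) (column≤L t<a))
    where
    s<1+s+t : ∀ t → s < suc s + t
    s<1+s+t t = s≤s (m≤m+n s t)
    column≤L : ∀ {t} → t < a → suc s + t ≤ s + a
    column≤L {t} t<a = subst (_≤ s + a) (+-suc s t) (+-monoʳ-≤ s t<a)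
    offset<a : ∀ {c} → s < c → c ≤ s + a → c ∸ suc s < a
    offset<a {c} s<c c≤L = +-cancelˡ-≤ s _ a (subst (_≤ s + a) (sym (trans (+-suc s _) (m+[n∸m]≡n s<c))) c≤L)

unionRSize-admissible : ∀ {k Q} → Admissible k Q → ∀ i₀ → i₀ < length Q →
  unionRSize k (map outer Q) (length Q) (suc i₀) ≡ row (map proj₂ Q) (suc i₀)
unionRSize-admissible {Q = Q} A i₀ i₀<ℓ with row-split Q i₀ i₀<ℓ
... | _ , _ , _ , split , row≡a = trans (unionRSize≡ A {i₀} split) (sym row≡a)

proposition3p1 : (k : ℕ) → 0 < k → (μ : List ℕ) → IsPartition μ → KBounded k μ →
    (i : ℕ) → 1 ≤ i → i ≤ length μ →
    unionRSize k (core k μ) (length μ) i ≡ row μ i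
proposition3p1 k _ μ (decreasing , _) bounded (suc i₀) _ i≤ℓ = begin
  unionRSize k (core k μ) (length μ) (suc i₀)
    ≡⟨ cong₂ (λ γ ℓ → unionRSize k γ ℓ (suc i₀)) (core≡map-outer k μ) (sym ℓ≡) ⟩
  unionRSize k (map outer Q) (length Q) (suc i₀)
    ≡⟨ unionRSize-admissible A i₀ (subst (i₀ <_) (sym ℓ≡) i≤ℓ) ⟩
  row (map proj₂ Q) (suc i₀)
    ≡⟨ cong (λ ν → row ν (suc i₀)) (placeRows-lengths k μ) ⟩
  row μ (suc i₀)
    ∎
  where
  open ≡-Reasoning
  Q = placeRows k μ
  A = placeRows-admissible k μ decreasing bounded
  ℓ≡ : length Q ≡ length μ
  ℓ≡ = trans (sym (length-map proj₂ Q)) (cong length (placeRows-lengths k μ))
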